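{- Let $(X,d_X)$ and $(Y,d_Y)$ be metric spaces inducing echelons $\leq_\mathbf{X}$ and $\leq_\mathbf{Y}$, respectively, and let $f\colon(X,\leq_\mathbf{X})\to(Y,\leq_\mathbf{Y})$ be a surjective homomorphism. If $(X,d_X)$ and $(Y,d_Y)$ have midpoints, then for all $x,y\in X$ we have $f[\mathrm{Mid}_X(x,y)]\subseteq\mathrm{Mid}_Y(f(x),f(y))$.
   Context: The echelon induced by a metric $d$ on a set $Z$ is the relation $\leq$ on $Z^2$ with $(x_1,y_1)\leq(x_2,y_2)\iff d(x_1,y_1)\leq d(x_2,y_2)$. A homomorphism $f\colon(X,\leq_\mathbf{X})\to(Y,\leq_\mathbf{Y})$ is a map $f\colon X\to Y$ such that $(x_1,x_2)\leq_\mathbf{X}(y_1,y_2)$ implies $(f(x_1),f(x_2))\leq_\mathbf{Y}(f(y_1),f(y_2))$. A point $z$ is a midpoint of $x,y$ in $(X,d_X)$ if $d_X(z,x)=d_X(z,y)=\frac12 d_X(x,y)$; $\mathrm{Mid}_X(x,y)$ denotes the set of all midpoints of $x$ and $y$; $(X,d_X)$ has midpoints if every pair has a midpoint. -}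

module Defs where

open import Level using (0ℓ)
open import Data.Product using (Σ; ∃; _×_; _,_)
open import Relation.Nullary using (¬_)
open import Relation.Binary.PropositionalEquality using (_≡_; _≢_)
open import Algebra.Structures using (IsCommutativeRing)
open import Relation.Binary.Structures using (IsTotalOrder)

-- The real numbers, axiomatised as a (Dedekind-)complete ordered field.
-- (agda-stdlib has no reals; every model of this record is isomorphic to ℝ.)
record RealField : Set₁ where
  infixl 6 _+_
  infixl 7 _*_
  infix 4 _≤_
  field
    ℝ    : Set
    _+_  : ℝ → ℝ → ℝ
    _*_  : ℝ → ℝ → ℝ
    -_   : ℝ → ℝ
    0r   : ℝ
    1r   : ℝ
    _⁻¹  : ℝ → ℝ
    _≤_  : ℝ → ℝ → Set
    isCommutativeRing : IsCommutativeRing _≡_ _+_ _*_ -_ 0r 1r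
    0≢1   : 0r ≢ 1r
    ⁻¹-inverse : ∀ x → x ≢ 0r → x * x ⁻¹ ≡ 1r
    isTotalOrder : IsTotalOrder _≡_ _≤_
    +-mono-≤ : ∀ x y z → x ≤ y → x + z ≤ y + z
    *-nonneg : ∀ x y → 0r ≤ x → 0r ≤ y → 0r ≤ x * y
    complete : (P : ℝ → Set) → (∃ λ x → P x) → (∃ λ b → ∀ x → P x → x ≤ b) →
               ∃ λ s → (∀ x → P x → x ≤ s) × (∀ b → (∀ x → P x → x ≤ b) → s ≤ b)

  ½ : ℝ
  ½ = (1r + 1r) ⁻¹

record MetricSpace (R : RealField) : Set₁ where
  open RealField R
  field
    Carrier : Set
    d       : Carrier → Carrier → ℝ
    d-nonneg : ∀ x y → 0r ≤ d x y
    d-zero⇒≡ : ∀ x y → d x y ≡ 0r → x ≡ y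
    d-refl   : ∀ x → d x x ≡ 0r
    d-sym    : ∀ x y → d x y ≡ d y x
    d-triangle : ∀ x y z → d x z ≤ d x y + d y z

Surjective : {A B : Set} → (A → B) → Set
Surjective {A} {B} f = ∀ (b : B) → ∃ λ a → f a ≡ b

module _ {R : RealField} where
  open RealField R
  open MetricSpace

  Echelon : (X : MetricSpace R) → (Carrier X × Carrier X) → (Carrier X × Carrier X) → Set
  Echelon X (x₁ , y₁) (x₂ , y₂) = d X x₁ y₁ ≤ d X x₂ y₂

  IsEchelonHom : (X Y : MetricSpace R) → (Carrier X → Carrier Y) → Set
  IsEchelonHom X Y f = ∀ x₁ x₂ y₁ y₂ →
    Echelon X (x₁ , x₂) (y₁ , y₂) → Echelon Y (f x₁ , f x₂) (f y₁ , f y₂)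

  IsMidpoint : (X : MetricSpace R) → Carrier X → Carrier X → Carrier X → Set
  IsMidpoint X x y z = (d X z x ≡ ½ * d X x y) × (d X z y ≡ ½ * d X x y)

  HasMidpoints : MetricSpace R → Set
  HasMidpoints X = ∀ x y → ∃ λ z → IsMidpoint X x y z

-- Let z be a midpoint of x and y. Since d(z,x) = d(z,y), the homomorphism gives
-- d(fz,fx) = d(fz,fy) =: a, and the triangle inequality gives d(fx,fy) ≤ 2a.
-- Conversely, pick a midpoint w of fx and fy and some u with fu = w. As
-- d(u,x) + d(u,y) ≥ d(x,y) = 2 d(z,x), the point u is at least as far as z from
-- x or from y, so the homomorphism gives a ≤ d(w,fx) or a ≤ d(w,fy), i.e.
-- a ≤ d(fx,fy)/2 either way.
module Submission where

open import Defs
open import Data.Product using (_,_)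
open import Data.Sum using (_⊎_; inj₁; inj₂)
open import Relation.Binary.PropositionalEquality
  using (_≡_; _≢_; refl; sym; trans; cong; cong₂)
open import Algebra.Structures using (IsCommutativeRing)
open import Relation.Binary.Structures using (IsTotalOrder)
import Relation.Binary.Reasoning.Base.Double as ≤-ReasoningOf

module RealFieldProperties (R : RealField) where
  open RealField R
  open IsCommutativeRing isCommutativeRing
    using (+-assoc; +-comm; +-identityˡ; +-identityʳ; -‿inverseʳ; *-identityˡ; distribʳ)
  open IsTotalOrder isTotalOrder public
    using (total; antisym; isPreorder) renaming (reflexive to ≤-reflexive)
  open ≤-ReasoningOf isPreorder public

  +-cancelʳ-≤ : ∀ x y z → x + z ≤ y + z → x ≤ y
  +-cancelʳ-≤ x y z x+z≤y+z = begin
    x             ≡⟨ sym (+-identityʳ x) ⟩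
    x + 0r        ≡⟨ cong (x +_) (sym (-‿inverseʳ z)) ⟩
    x + (z + - z) ≡⟨ sym (+-assoc x z (- z)) ⟩
    x + z + - z   ≲⟨ +-mono-≤ _ _ (- z) x+z≤y+z ⟩
    y + z + - z   ≡⟨ +-assoc y z (- z) ⟩
    y + (z + - z) ≡⟨ cong (y +_) (-‿inverseʳ z) ⟩
    y + 0r        ≡⟨ +-identityʳ y ⟩
    y             ∎

  +-monoʳ-≤ : ∀ x y z → y ≤ z → x + y ≤ x + z
  +-monoʳ-≤ x y z y≤z = begin
    x + y ≡⟨ +-comm x y ⟩
    y + x ≲⟨ +-mono-≤ y z x y≤z ⟩
    z + x ≡⟨ +-comm z x ⟩
    x + z ∎

  x+x≤y+z⇒x≤y⊎x≤z : ∀ x y z → x + x ≤ y + z → x ≤ y ⊎ x ≤ z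
  x+x≤y+z⇒x≤y⊎x≤z x y z x+x≤y+z with total x z
  ... | inj₁ x≤z = inj₂ x≤z
  ... | inj₂ z≤x = inj₁ (+-cancelʳ-≤ x y x (begin
    x + x ≲⟨ x+x≤y+z ⟩
    y + z ≲⟨ +-monoʳ-≤ y z x z≤x ⟩
    y + x ∎))

  1+1≢0 : 1r + 1r ≢ 0r
  1+1≢0 2≡0 with total 0r 1r
  ... | inj₁ 0≤1 = 0≢1 (antisym 0≤1 (begin
    1r       ≡⟨ sym (+-identityˡ 1r) ⟩
    0r + 1r  ≲⟨ +-mono-≤ 0r 1r 1r 0≤1 ⟩
    1r + 1r  ≡⟨ 2≡0 ⟩
    0r       ∎))
  ... | inj₂ 1≤0 = 0≢1 (antisym (begin
    0r       ≡⟨ sym 2≡0 ⟩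
    1r + 1r  ≲⟨ +-mono-≤ 1r 0r 1r 1≤0 ⟩
    0r + 1r  ≡⟨ +-identityˡ 1r ⟩
    1r       ∎) 1≤0)

  ½x+½x≡x : ∀ x → ½ * x + ½ * x ≡ x
  ½x+½x≡x x = begin-equality
    ½ * x + ½ * x ≡⟨ sym (distribʳ x ½ ½) ⟩
    (½ + ½) * x   ≡⟨ cong (_* x) ½+½≡1 ⟩
    1r * x        ≡⟨ *-identityˡ x ⟩
    x             ∎
    where
    ½+½≡1 : ½ + ½ ≡ 1r
    ½+½≡1 = begin-equality
      ½ + ½               ≡⟨ sym (cong₂ _+_ (*-identityˡ ½) (*-identityˡ ½)) ⟩
      1r * ½ + 1r * ½     ≡⟨ sym (distribʳ ½ 1r 1r) ⟩
      (1r + 1r) * ½       ≡⟨ ⁻¹-inverse (1r + 1r) 1+1≢0 ⟩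
      1r                  ∎

  ≤½y∧y≤x+x⇒≡½y : ∀ x y → x ≤ ½ * y → y ≤ x + x → x ≡ ½ * y
  ≤½y∧y≤x+x⇒≡½y x y x≤½y y≤x+x = antisym x≤½y ½y≤x
    where
    ½y≤x : ½ * y ≤ x
    ½y≤x = +-cancelʳ-≤ (½ * y) x (½ * y) (begin
      ½ * y + ½ * y ≡⟨ ½x+½x≡x y ⟩
      y             ≲⟨ y≤x+x ⟩
      x + x         ≲⟨ +-monoʳ-≤ x x (½ * y) x≤½y ⟩
      x + ½ * y     ∎)

module MetricSpaceProperties {R : RealField} (X : MetricSpace R) where
  open RealField R
  open MetricSpace X
  open RealFieldProperties R

  d-triangle-at : ∀ x y z → d x y ≤ d z x + d z y
  d-triangle-at x y z = begin
    d x y         ≲⟨ d-triangle x z y ⟩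
    d x z + d z y ≡⟨ cong (_+ d z y) (d-sym x z) ⟩
    d z x + d z y ∎

  midpoint-equidistant : ∀ {x y z} → IsMidpoint X x y z → d z x ≡ d z y
  midpoint-equidistant (zx≡½xy , zy≡½xy) = trans zx≡½xy (sym zy≡½xy)

  equidistant-≥½ : ∀ x y z → d z x ≡ d z y → d x y ≤ d z x + d z x
  equidistant-≥½ x y z zx≡zy = begin
    d x y         ≲⟨ d-triangle-at x y z ⟩
    d z x + d z y ≡⟨ cong (d z x +_) (sym zx≡zy) ⟩
    d z x + d z x ∎

  midpoint-nearest : ∀ {x y z} → IsMidpoint X x y z → ∀ u → d z x ≤ d u x ⊎ d z y ≤ d u y
  midpoint-nearest {x} {y} {z} mid@(zx≡½xy , _) u
    with x+x≤y+z⇒x≤y⊎x≤z (d z x) (d u x) (d u y) (begin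
      d z x + d z x         ≡⟨ cong₂ _+_ zx≡½xy zx≡½xy ⟩
      ½ * d x y + ½ * d x y ≡⟨ ½x+½x≡x (d x y) ⟩
      d x y                 ≲⟨ d-triangle-at x y u ⟩
      d u x + d u y         ∎)
  ... | inj₁ zx≤ux = inj₁ zx≤ux
  ... | inj₂ zx≤uy = inj₂ (begin
    d z y ≡⟨ sym (midpoint-equidistant mid) ⟩
    d z x ≲⟨ zx≤uy ⟩
    d u y ∎)

module EchelonHomProperties {R : RealField} (X Y : MetricSpace R)
  (f : MetricSpace.Carrier X → MetricSpace.Carrier Y) (hom : IsEchelonHom X Y f) where
  open RealField R
  open MetricSpace
  open RealFieldProperties R using (antisym; ≤-reflexive; begin_; step-≡-⟩; step-≲; _∎)
  open MetricSpaceProperties using (midpoint-equidistant; midpoint-nearest)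

  hom-preserves-≡ : ∀ x₁ x₂ y₁ y₂ → d X x₁ x₂ ≡ d X y₁ y₂ → d Y (f x₁) (f x₂) ≡ d Y (f y₁) (f y₂)
  hom-preserves-≡ x₁ x₂ y₁ y₂ eq =
    antisym (hom x₁ x₂ y₁ y₂ (≤-reflexive eq)) (hom y₁ y₂ x₁ x₂ (≤-reflexive (sym eq)))

  midpoint-image-equidistant : ∀ {x y z} → IsMidpoint X x y z → d Y (f z) (f x) ≡ d Y (f z) (f y)
  midpoint-image-equidistant {x} {y} {z} mid = hom-preserves-≡ z x z y (midpoint-equidistant X mid)

  midpoint-image-≤½ : ∀ {x y z} → IsMidpoint X x y z →
                      ∀ u → IsMidpoint Y (f x) (f y) (f u) → d Y (f z) (f x) ≤ ½ * d Y (f x) (f y)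
  midpoint-image-≤½ {x} {y} {z} mid u (fu-x≡½ , fu-y≡½) with midpoint-nearest X mid u
  ... | inj₁ zx≤ux = begin
    d Y (f z) (f x)     ≲⟨ hom z x u x zx≤ux ⟩
    d Y (f u) (f x)     ≡⟨ fu-x≡½ ⟩
    ½ * d Y (f x) (f y) ∎
  ... | inj₂ zy≤uy = begin
    d Y (f z) (f x)     ≡⟨ midpoint-image-equidistant mid ⟩
    d Y (f z) (f y)     ≲⟨ hom z y u y zy≤uy ⟩
    d Y (f u) (f y)     ≡⟨ fu-y≡½ ⟩
    ½ * d Y (f x) (f y) ∎

  midpoint-image-isMidpoint : ∀ {x y z} → IsMidpoint X x y z →
                              ∀ u → IsMidpoint Y (f x) (f y) (f u) → IsMidpoint Y (f x) (f y) (f z)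
  midpoint-image-isMidpoint {x} {y} {z} mid u fu-mid = fz-x≡½ , trans (sym fz-equidistant) fz-x≡½
    where
    open MetricSpaceProperties Y using (equidistant-≥½)
    open RealFieldProperties R using (≤½y∧y≤x+x⇒≡½y)

    fz-equidistant : d Y (f z) (f x) ≡ d Y (f z) (f y)
    fz-equidistant = midpoint-image-equidistant mid

    fz-x≡½ : d Y (f z) (f x) ≡ ½ * d Y (f x) (f y)
    fz-x≡½ = ≤½y∧y≤x+x⇒≡½y _ _ (midpoint-image-≤½ mid u fu-mid)
                                 (equidistant-≥½ (f x) (f y) (f z) fz-equidistant)

lemma2p6 : (R : RealField) (X Y : MetricSpace R) (f : MetricSpace.Carrier X → MetricSpace.Carrier Y) →
           Surjective f → IsEchelonHom X Y f → HasMidpoints X → HasMidpoints Y →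
           ∀ x y z → IsMidpoint X x y z → IsMidpoint Y (f x) (f y) (f z)
lemma2p6 R X Y f surj hom _ midY x y z mid with midY (f x) (f y)
... | w , w-mid with surj w
...   | u , refl = midpoint-image-isMidpoint mid u w-mid
  where open EchelonHomProperties X Y f hom
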